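{- For any permutations $\sigma,\tau\in S_n$ and any integers $1\le u,v,w\le n$: - $M(\sigma,u,0)\,M(\tau,v,0)=M(\tau\sigma,w,0)$; - $M(\sigma,u,1)\,M(\tau,v,0)=M(\tau\sigma,u,1)$; - $M(\sigma,u,0)\,M(\tau,v,1)=M(\tau\sigma,\sigma^{ -1}(v),1)$; - $M(\sigma,u,1)\,M(\tau,v,1)=M(\tau\sigma,w,0)$ if $\sigma^{ -1}(v)=u$, and $M(\sigma,u,1)\,M(\tau,v,1)=M(\eta,\sigma^{ -1}(v),1)$ if $\sigma^{ -1}(v)\ne u$. In the last case $\eta\in S_n$ is defined by: - $\eta(j)=\tau\sigma(j)$ for $j\notin\{u,\sigma^{ -1}(v)\}$; - $\eta(\sigma^{ -1}(v))=\tau\sigma(u)$; - $\eta(u)=\tau\sigma(\sigma^{ -1}(v))=\tau(v)$.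
   Context: Let $n$ be a positive integer, let $\mathbf{e}_j$ be the $j$-th standard basis column vector of $\mathbb{Z}^n$, and let $\mathbf{r}_h=\big((-1)^h,(-1)^{h+1},\dots,(-1)^{h+n-1}\big)$ be a row vector. Permutations compose as functions: $(\tau\sigma)(j)=\tau(\sigma(j))$. For $\sigma\in S_n$, $h\in\{1,\dots,n\}$ and $\epsilon\in\{0,1\}$ define the $n\times n$ matrix $$M(\sigma,h,\epsilon)=\sum_{j=1}^n(-1)^{j+\sigma(j)}\mathbf{e}_j\mathbf{e}_{\sigma(j)}^T+\epsilon\Big((-1)^{h+\sigma(h)+1}\mathbf{e}_h\mathbf{e}_{\sigma(h)}^T+\mathbf{e}_h\mathbf{r}_h\Big).$$ Thus $M(\sigma,h,0)$ is a signed permutation matrix with entry $(-1)^{j+\sigma(j)}$ at position $(j,\sigma(j))$, and it does not depend on $h$. For $\epsilon=1$, row $h$ is replaced by $\mathbf{r}_h$. -}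

module Defs where

open import Data.Nat using (ℕ; zero; suc) renaming (_+_ to _ℕ+_)
open import Data.Bool using (Bool; true; false)
open import Data.Fin using (Fin; toℕ; _≟_)
import Data.Fin as F
open import Data.Fin.Permutation using (Permutation′; _⟨$⟩ʳ_; _∘ₚ_)
open import Data.Integer using (ℤ; +_; -_; _+_; _*_; _^_)
open import Relation.Nullary using (yes; no)
open import Relation.Binary.PropositionalEquality using (_≡_)

-- Indices are 0-based (Fin n); paper index j corresponds to toℕ j + 1.
-- Signs (-1)^(j+σ(j)) only depend on parity, which is unchanged by the shift.

sgn : ℕ → ℤ
sgn m = (- (+ 1)) ^ m

-- Product of permutations as in the paper: (τ · σ)(j) = τ (σ j).
-- (stdlib's π₁ ∘ₚ π₂ applies π₁ first.)
_·_ : ∀ {n} → Permutation′ n → Permutation′ n → Permutation′ n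
τ · σ = σ ∘ₚ τ

Matrix : ℕ → Set
Matrix n = Fin n → Fin n → ℤ

⟦_⟧ : Bool → ℤ
⟦ false ⟧ = + 0
⟦ true ⟧ = + 1

unit : ∀ {n} → Fin n → Fin n → Fin n → Fin n → ℤ
unit a b i k with i ≟ a | k ≟ b
... | yes _ | yes _ = + 1
... | _     | _     = + 0

-- e_h r_h entry (i,k); paper r_h has (1-based) column-k entry (-1)^(h+k-1),
-- which in 0-based indices h', k' is (-1)^(h'+k'+1).
rowR : ∀ {n} → Fin n → Fin n → Fin n → ℤ
rowR h i k with i ≟ h
... | yes _ = sgn (toℕ h ℕ+ toℕ k ℕ+ 1)
... | no _  = + 0

∑ : ∀ {n} → (Fin n → ℤ) → ℤ
∑ {zero}  f = + 0
∑ {suc n} f = f F.zero + ∑ (λ i → f (F.suc i))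

M : ∀ {n} → Permutation′ n → Fin n → Bool → Matrix n
M σ h ε i k =
  ∑ (λ j → sgn (toℕ j ℕ+ toℕ (σ ⟨$⟩ʳ j)) * unit j (σ ⟨$⟩ʳ j) i k)
  + ⟦ ε ⟧ * ( sgn (toℕ h ℕ+ toℕ (σ ⟨$⟩ʳ h) ℕ+ 1) * unit h (σ ⟨$⟩ʳ h) i k
            + rowR h i k)

infixl 7 _⊗_
infix 4 _≐_
_⊗_ : ∀ {n} → Matrix n → Matrix n → Matrix n
(A ⊗ B) i k = ∑ (λ j → A i j * B j k)

_≐_ : ∀ {n} → Matrix n → Matrix n → Set
A ≐ B = ∀ i k → A i k ≡ B i k

{-# OPTIONS --safe #-}
-- With D = diag((-1)^i) we have D² = 1 and M σ h ε = D N D, where N is the permutation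
-- matrix of σ (a 1 at (i, σ i)), with row h overwritten by -1's when ε = true. So it suffices
-- to multiply the unsigned matrices N. There, P_σ B is B with rows permuted by σ, and a row of
-- -1's times B is minus the column sums of B; these are 1 for P_τ and -[k = τ v] for P_τ with
-- row v overwritten, and the four products follow by comparing rows.
module Submission where

open import Defs
open import Data.Bool using (Bool; true; false)
open import Data.Nat using (ℕ; zero; suc) renaming (_+_ to _ℕ+_)
open import Data.Fin using (Fin; toℕ; _≟_)
import Data.Fin as F using (zero; suc)
open import Data.Fin.Properties using (suc-injective)
open import Data.Fin.Permutation using (Permutation′; _⟨$⟩ʳ_; _⟨$⟩ˡ_; inverseʳ)
open import Data.Integer using (ℤ; -_; _+_; _*_; _-_; 0ℤ; 1ℤ; -1ℤ)
open import Data.Integer.Properties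
  using ( ^-distribˡ-+-*; +-identityˡ; +-identityʳ; *-zeroˡ; *-zeroʳ; *-identityˡ; *-identityʳ
        ; *-distribˡ-+; -1*i≡-i; neg-involutive)
open import Data.Integer.Tactic.RingSolver using (solve-∀)
open import Data.Product using (_×_; _,_)
open import Function using (Inverse; _∘_)
open import Relation.Nullary using (Dec; yes; no; contradiction)
open import Relation.Binary.PropositionalEquality

private variable
  n : ℕ

∑-cong : {f g : Fin n → ℤ} → (∀ j → f j ≡ g j) → ∑ f ≡ ∑ g
∑-cong {zero}  f≗g = refl
∑-cong {suc n} f≗g = cong₂ _+_ (f≗g F.zero) (∑-cong (f≗g ∘ F.suc))

∑-zero : {f : Fin n → ℤ} → (∀ j → f j ≡ 0ℤ) → ∑ f ≡ 0ℤ
∑-zero {zero}  f≗0 = refl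
∑-zero {suc n} f≗0 = cong₂ _+_ (f≗0 F.zero) (∑-zero (f≗0 ∘ F.suc))

*-distribˡ-∑ : ∀ c (f : Fin n → ℤ) → c * ∑ f ≡ ∑ (λ j → c * f j)
*-distribˡ-∑ {zero}  c f = *-zeroʳ c
*-distribˡ-∑ {suc n} c f =
  trans (*-distribˡ-+ c (f F.zero) (∑ (f ∘ F.suc))) (cong (c * f F.zero +_) (*-distribˡ-∑ c (f ∘ F.suc)))

∑-pointMass : {f : Fin n → ℤ} (a : Fin n) → (∀ j → j ≢ a → f j ≡ 0ℤ) → ∑ f ≡ f a
∑-pointMass {suc n} {f} F.zero f≗0 =
  trans (cong (f F.zero +_) (∑-zero (λ j → f≗0 (F.suc j) λ ()))) (+-identityʳ (f F.zero))
∑-pointMass {suc n} {f} (F.suc a) f≗0 =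
  trans (cong₂ _+_ (f≗0 F.zero λ ()) (∑-pointMass a (λ j j≢a → f≗0 (F.suc j) (j≢a ∘ suc-injective))))
        (+-identityˡ (f (F.suc a)))

∑-except : {f g : Fin n → ℤ} (a : Fin n) → (∀ j → j ≢ a → f j ≡ g j) → ∑ f ≡ ∑ g - g a + f a
∑-except {suc n} {f} {g} F.zero f≗g =
  trans (cong (f F.zero +_) (∑-cong (λ j → f≗g (F.suc j) λ ()))) (swap (f F.zero) (g F.zero) _)
  where
  swap : ∀ x y s → x + s ≡ y + s - y + x
  swap = solve-∀
∑-except {suc n} {f} {g} (F.suc a) f≗g =
  trans (cong₂ _+_ (f≗g F.zero λ ()) (∑-except a (λ j j≢a → f≗g (F.suc j) (j≢a ∘ suc-injective))))
        (reassoc (g F.zero) _ _ _)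
  where
  reassoc : ∀ x s p q → x + (s - p + q) ≡ x + s - p + q
  reassoc = solve-∀

δ : Fin n → Fin n → ℤ
δ i j with i ≟ j
... | yes _ = 1ℤ
... | no  _ = 0ℤ

δ-refl : (i : Fin n) → δ i i ≡ 1ℤ
δ-refl i with i ≟ i
... | yes _   = refl
... | no  i≢i = contradiction refl i≢i

δ-≢ : {i j : Fin n} → i ≢ j → δ i j ≡ 0ℤ
δ-≢ {i = i} {j} i≢j with i ≟ j
... | yes i≡j = contradiction i≡j i≢j
... | no  _   = refl

*-δ-subst : (f : Fin n → ℤ) (i j : Fin n) → f j * δ i j ≡ f i * δ i j
*-δ-subst f i j with i ≟ j
... | yes refl = refl
... | no  _    = trans (*-zeroʳ (f j)) (sym (*-zeroʳ (f i)))

unit-offRow : ∀ {a b i : Fin n} k → i ≢ a → unit a b i k ≡ 0ℤ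
unit-offRow {a = a} {b} {i} k i≢a with i ≟ a | k ≟ b
... | yes i≡a | yes _ = contradiction i≡a i≢a
... | yes _   | no  _ = refl
... | no  _   | _     = refl

unit-onRow : ∀ (a b k : Fin n) → unit a b a k ≡ δ k b
unit-onRow a b k with a ≟ a | k ≟ b
... | yes _   | yes _ = refl
... | yes _   | no  _ = refl
... | no  a≢a | _     = contradiction refl a≢a

rowR-offRow : ∀ {h i : Fin n} k → i ≢ h → rowR h i k ≡ 0ℤ
rowR-offRow {h = h} {i} k i≢h with i ≟ h
... | yes i≡h = contradiction i≡h i≢h
... | no  _   = refl

rowR-onRow : ∀ (h k : Fin n) → rowR h h k ≡ sgn (toℕ h ℕ+ toℕ k ℕ+ 1)
rowR-onRow h k with h ≟ h
... | yes _   = refl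
... | no  h≢h = contradiction refl h≢h

sgn-+ : ∀ a b → sgn (a ℕ+ b) ≡ sgn a * sgn b
sgn-+ = ^-distribˡ-+-* -1ℤ

sgn-+-suc : ∀ a b → sgn (a ℕ+ b ℕ+ 1) ≡ - (sgn a * sgn b)
sgn-+-suc a b = begin
  sgn (a ℕ+ b ℕ+ 1)          ≡⟨ sgn-+ (a ℕ+ b) 1 ⟩
  sgn (a ℕ+ b) * -1ℤ         ≡⟨ cong (_* -1ℤ) (sgn-+ a b) ⟩
  sgn a * sgn b * -1ℤ        ≡⟨ *-neg-one (sgn a * sgn b) ⟩
  - (sgn a * sgn b)          ∎
  where
  open ≡-Reasoning
  *-neg-one : ∀ x → x * -1ℤ ≡ - x
  *-neg-one = solve-∀

sgn-*-sgn : ∀ m → sgn m * sgn m ≡ 1ℤ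
sgn-*-sgn zero    = refl
sgn-*-sgn (suc m) = trans (neg-*-neg (sgn m)) (sgn-*-sgn m)
  where
  neg-*-neg : ∀ x → (-1ℤ * x) * (-1ℤ * x) ≡ x * x
  neg-*-neg = solve-∀

sgnᶠ : Fin n → ℤ
sgnᶠ i = sgn (toℕ i)

signed : Matrix n → Matrix n
signed A i k = sgnᶠ i * sgnᶠ k * A i k

signed-cong : {A B : Matrix n} → A ≐ B → signed A ≐ signed B
signed-cong A≐B i k = cong (sgnᶠ i * sgnᶠ k *_) (A≐B i k)

⊗-cong : {A A′ B B′ : Matrix n} → A ≐ A′ → B ≐ B′ → A ⊗ B ≐ A′ ⊗ B′
⊗-cong A≐A′ B≐B′ i k = ∑-cong (λ j → cong₂ _*_ (A≐A′ i j) (B≐B′ j k))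

signed-⊗ : (A B : Matrix n) → signed A ⊗ signed B ≐ signed (A ⊗ B)
signed-⊗ A B i k =
  trans (∑-cong cancel) (sym (*-distribˡ-∑ (sᵢ * sₖ) (λ j → A i j * B j k)))
  where
  sᵢ sₖ : ℤ
  sᵢ = sgnᶠ i
  sₖ = sgnᶠ k
  regroup : ∀ x y z a b → x * z * a * (z * y * b) ≡ x * y * (a * b) * (z * z)
  regroup = solve-∀
  cancel : ∀ j → sᵢ * sgnᶠ j * A i j * (sgnᶠ j * sₖ * B j k) ≡ sᵢ * sₖ * (A i j * B j k)
  cancel j =
    trans (regroup sᵢ sₖ (sgnᶠ j) (A i j) (B j k))
          (trans (cong (sᵢ * sₖ * (A i j * B j k) *_) (sgn-*-sgn (toℕ j))) (*-identityʳ _))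

withRow : Fin n → (Fin n → ℤ) → Matrix n → Matrix n
withRow h r A i with i ≟ h
... | yes _ = r
... | no  _ = A i

withRow-≡ : ∀ h r (A : Matrix n) k → withRow h r A h k ≡ r k
withRow-≡ h r A k with h ≟ h
... | yes _   = refl
... | no  h≢h = contradiction refl h≢h

withRow-≢ : ∀ {h i : Fin n} r (A : Matrix n) k → i ≢ h → withRow h r A i k ≡ A i k
withRow-≢ {h = h} {i} r A k i≢h with i ≟ h
... | yes i≡h = contradiction i≡h i≢h
... | no  _   = refl

withRow-cong : ∀ h {r r′ : Fin n → ℤ} {A B : Matrix n} →
               (∀ k → r k ≡ r′ k) → A ≐ B → withRow h r A ≐ withRow h r′ B
withRow-cong h r≗r′ A≐B i k with i ≟ h
... | yes _ = r≗r′ k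
... | no  _ = A≐B i k

negOnes : Fin n → ℤ
negOnes _ = -1ℤ

permMatrix : Permutation′ n → Matrix n
permMatrix σ i k = δ k (σ ⟨$⟩ʳ i)

unsignedM : Permutation′ n → Fin n → Bool → Matrix n
unsignedM σ h false = permMatrix σ
unsignedM σ h true  = withRow h negOnes (permMatrix σ)

signedPermSum : (σ : Permutation′ n) (i k : Fin n) →
  ∑ (λ j → sgn (toℕ j ℕ+ toℕ (σ ⟨$⟩ʳ j)) * unit j (σ ⟨$⟩ʳ j) i k) ≡ signed (permMatrix σ) i k
signedPermSum σ i k = begin
  ∑ (λ j → sign j * unit j (σ ⟨$⟩ʳ j) i k)        ≡⟨ ∑-pointMass i offRow ⟩
  sign i * unit i (σ ⟨$⟩ʳ i) i k                  ≡⟨ cong (sign i *_) (unit-onRow i (σ ⟨$⟩ʳ i) k) ⟩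
  sgn (toℕ i ℕ+ toℕ (σ ⟨$⟩ʳ i)) * δ k (σ ⟨$⟩ʳ i)  ≡⟨ *-δ-subst (λ b → sgn (toℕ i ℕ+ toℕ b)) k (σ ⟨$⟩ʳ i) ⟩
  sgn (toℕ i ℕ+ toℕ k) * δ k (σ ⟨$⟩ʳ i)           ≡⟨ cong (_* δ k (σ ⟨$⟩ʳ i)) (sgn-+ (toℕ i) (toℕ k)) ⟩
  signed (permMatrix σ) i k                       ∎
  where
  open ≡-Reasoning
  sign : Fin _ → ℤ
  sign j = sgn (toℕ j ℕ+ toℕ (σ ⟨$⟩ʳ j))
  offRow : ∀ j → j ≢ i → sign j * unit j (σ ⟨$⟩ʳ j) i k ≡ 0ℤ
  offRow j j≢i = trans (cong (sign j *_) (unit-offRow k (j≢i ∘ sym))) (*-zeroʳ (sign j))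

rowCorrection : Permutation′ n → Fin n → Matrix n
rowCorrection σ h i k = sgn (toℕ h ℕ+ toℕ (σ ⟨$⟩ʳ h) ℕ+ 1) * unit h (σ ⟨$⟩ʳ h) i k + rowR h i k

rowCorrection-offRow : (σ : Permutation′ n) {h i : Fin n} (k : Fin n) → i ≢ h → rowCorrection σ h i k ≡ 0ℤ
rowCorrection-offRow σ {h} k i≢h =
  trans (cong₂ (λ x y → c * x + y) (unit-offRow k i≢h) (rowR-offRow k i≢h))
        (trans (+-identityʳ _) (*-zeroʳ c))
  where
  c : ℤ
  c = sgn (toℕ h ℕ+ toℕ (σ ⟨$⟩ʳ h) ℕ+ 1)

rowCorrection-onRow : (σ : Permutation′ n) (h k : Fin n) →
  rowCorrection σ h h k ≡ - (sgnᶠ h * sgnᶠ k) * δ k (σ ⟨$⟩ʳ h) + - (sgnᶠ h * sgnᶠ k)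
rowCorrection-onRow σ h k = begin
  rowCorrection σ h h k
    ≡⟨ cong₂ (λ x y → sgn (toℕ h ℕ+ toℕ (σ ⟨$⟩ʳ h) ℕ+ 1) * x + y)
             (unit-onRow h (σ ⟨$⟩ʳ h) k) (rowR-onRow h k) ⟩
  sgn (toℕ h ℕ+ toℕ (σ ⟨$⟩ʳ h) ℕ+ 1) * δ k (σ ⟨$⟩ʳ h) + sgn (toℕ h ℕ+ toℕ k ℕ+ 1)
    ≡⟨ cong (_+ _) (*-δ-subst (λ b → sgn (toℕ h ℕ+ toℕ b ℕ+ 1)) k (σ ⟨$⟩ʳ h)) ⟩
  sgn (toℕ h ℕ+ toℕ k ℕ+ 1) * δ k (σ ⟨$⟩ʳ h) + sgn (toℕ h ℕ+ toℕ k ℕ+ 1)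
    ≡⟨ cong (λ x → x * δ k (σ ⟨$⟩ʳ h) + x) (sgn-+-suc (toℕ h) (toℕ k)) ⟩
  - (sgnᶠ h * sgnᶠ k) * δ k (σ ⟨$⟩ʳ h) + - (sgnᶠ h * sgnᶠ k) ∎
  where open ≡-Reasoning

M≐signed : (σ : Permutation′ n) (h : Fin n) (ε : Bool) → M σ h ε ≐ signed (unsignedM σ h ε)
M≐signed σ h false i k =
  trans (cong₂ _+_ (signedPermSum σ i k) (*-zeroˡ (rowCorrection σ h i k))) (+-identityʳ _)
M≐signed σ h true i k = byRow (i ≟ h)
  where
  open ≡-Reasoning
  collapse : ∀ x d → x * d + 1ℤ * (- x * d + - x) ≡ x * -1ℤ
  collapse = solve-∀
  byRow : Dec (i ≡ h) → M σ h true i k ≡ signed (unsignedM σ h true) i k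
  byRow (no i≢h) = begin
    M σ h true i k
      ≡⟨ cong₂ (λ x y → x + 1ℤ * y) (signedPermSum σ i k) (rowCorrection-offRow σ k i≢h) ⟩
    signed (permMatrix σ) i k + 0ℤ
      ≡⟨ +-identityʳ _ ⟩
    signed (permMatrix σ) i k
      ≡⟨ cong (sgnᶠ i * sgnᶠ k *_) (withRow-≢ _ (permMatrix σ) k i≢h) ⟨
    signed (unsignedM σ h true) i k ∎
  byRow (yes refl) = begin
    M σ i true i k
      ≡⟨ cong₂ (λ x y → x + 1ℤ * y) (signedPermSum σ i k) (rowCorrection-onRow σ i k) ⟩
    sgnᶠ i * sgnᶠ k * δ k (σ ⟨$⟩ʳ i) + 1ℤ * (- (sgnᶠ i * sgnᶠ k) * δ k (σ ⟨$⟩ʳ i) + - (sgnᶠ i * sgnᶠ k))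
      ≡⟨ collapse (sgnᶠ i * sgnᶠ k) (δ k (σ ⟨$⟩ʳ i)) ⟩
    sgnᶠ i * sgnᶠ k * -1ℤ
      ≡⟨ cong (sgnᶠ i * sgnᶠ k *_) (withRow-≡ i _ (permMatrix σ) k) ⟨
    signed (unsignedM σ i true) i k ∎

signed-⊗-transport : {A B C A′ B′ C′ : Matrix n} →
  A ≐ signed A′ → B ≐ signed B′ → C ≐ signed C′ → A′ ⊗ B′ ≐ C′ → A ⊗ B ≐ C
signed-⊗-transport {A = A} {B} {C} {A′} {B′} {C′} A≐ B≐ C≐ A′⊗B′≐C′ i k = begin
  (A ⊗ B) i k                  ≡⟨ ⊗-cong A≐ B≐ i k ⟩
  (signed A′ ⊗ signed B′) i k  ≡⟨ signed-⊗ A′ B′ i k ⟩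
  signed (A′ ⊗ B′) i k         ≡⟨ signed-cong A′⊗B′≐C′ i k ⟩
  signed C′ i k                ≡⟨ C≐ i k ⟨
  C i k                        ∎
  where open ≡-Reasoning

colSum : Matrix n → Fin n → ℤ
colSum A k = ∑ (λ j → A j k)

colSum-permMatrix : (τ : Permutation′ n) (k : Fin n) → colSum (permMatrix τ) k ≡ 1ℤ
colSum-permMatrix τ k =
  trans (∑-pointMass (τ ⟨$⟩ˡ k) (λ j j≢τ⁻¹k → δ-≢ (λ k≡τj → j≢τ⁻¹k (sym (Inverse.inverseʳ τ k≡τj)))))
        (trans (cong (δ k) (inverseʳ τ)) (δ-refl k))

colSum-withRow : ∀ h r (A : Matrix n) k → colSum (withRow h r A) k ≡ colSum A k - A h k + r k
colSum-withRow h r A k =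
  trans (∑-except h (λ j j≢h → withRow-≢ r A k j≢h)) (cong (colSum A k - A h k +_) (withRow-≡ h r A k))

colSum-negRow : (τ : Permutation′ n) (v k : Fin n) → colSum (unsignedM τ v true) k ≡ - δ k (τ ⟨$⟩ʳ v)
colSum-negRow τ v k =
  trans (colSum-withRow v negOnes (permMatrix τ) k)
        (trans (cong (λ c → c - δ k (τ ⟨$⟩ʳ v) + -1ℤ) (colSum-permMatrix τ k)) (cancel (δ k (τ ⟨$⟩ʳ v))))
  where
  cancel : ∀ d → 1ℤ - d + -1ℤ ≡ - d
  cancel = solve-∀

permMatrix-⊗ : (σ : Permutation′ n) (B : Matrix n) → permMatrix σ ⊗ B ≐ λ i → B (σ ⟨$⟩ʳ i)
permMatrix-⊗ σ B i k =
  trans (∑-pointMass (σ ⟨$⟩ʳ i) (λ j j≢σi → trans (cong (_* B j k) (δ-≢ j≢σi)) (*-zeroˡ (B j k))))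
        (trans (cong (_* B (σ ⟨$⟩ʳ i) k) (δ-refl (σ ⟨$⟩ʳ i))) (*-identityˡ (B (σ ⟨$⟩ʳ i) k)))

negRow-⊗ : ∀ h (A B : Matrix n) → withRow h negOnes A ⊗ B ≐ withRow h (λ k → - colSum B k) (A ⊗ B)
negRow-⊗ h A B i k = byRow (i ≟ h)
  where
  byRow : Dec (i ≡ h) → (withRow h negOnes A ⊗ B) i k ≡ withRow h (λ k → - colSum B k) (A ⊗ B) i k
  byRow (yes refl) =
    trans (∑-cong (λ j → cong (_* B j k) (withRow-≡ i _ A j)))
          (trans (sym (*-distribˡ-∑ -1ℤ (λ j → B j k)))
                 (trans (-1*i≡-i (colSum B k)) (sym (withRow-≡ i _ (A ⊗ B) k))))
  byRow (no i≢h) =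
    trans (∑-cong (λ j → cong (_* B j k) (withRow-≢ _ A j i≢h))) (sym (withRow-≢ _ (A ⊗ B) k i≢h))

withRow-permuteRows : (σ : Permutation′ n) (v : Fin n) (r : Fin n → ℤ) (A : Matrix n) →
  (λ i → withRow v r A (σ ⟨$⟩ʳ i)) ≐ withRow (σ ⟨$⟩ˡ v) r (λ i → A (σ ⟨$⟩ʳ i))
withRow-permuteRows σ v r A i k with i ≟ σ ⟨$⟩ˡ v
... | yes refl = trans (cong (λ x → withRow v r A x k) (inverseʳ σ)) (withRow-≡ v r A k)
... | no  i≢σ⁻¹v = withRow-≢ r A k (λ σi≡v → i≢σ⁻¹v (sym (Inverse.inverseʳ σ (sym σi≡v))))

negRow-⊗-perm : (σ τ : Permutation′ n) (u : Fin n) →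
  unsignedM σ u true ⊗ permMatrix τ ≐ unsignedM (τ · σ) u true
negRow-⊗-perm σ τ u i k =
  trans (negRow-⊗ u (permMatrix σ) (permMatrix τ) i k)
        (withRow-cong u (λ k → cong -_ (colSum-permMatrix τ k)) (permMatrix-⊗ σ (permMatrix τ)) i k)

perm-⊗-negRow : (σ τ : Permutation′ n) (v : Fin n) →
  permMatrix σ ⊗ unsignedM τ v true ≐ unsignedM (τ · σ) (σ ⟨$⟩ˡ v) true
perm-⊗-negRow σ τ v i k =
  trans (permMatrix-⊗ σ (unsignedM τ v true) i k) (withRow-permuteRows σ v negOnes (permMatrix τ) i k)

negRow-⊗-negRow : (σ τ : Permutation′ n) (u v : Fin n) →
  unsignedM σ u true ⊗ unsignedM τ v true
    ≐ withRow u (λ k → δ k (τ ⟨$⟩ʳ v)) (unsignedM (τ · σ) (σ ⟨$⟩ˡ v) true)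
negRow-⊗-negRow σ τ u v i k =
  trans (negRow-⊗ u (permMatrix σ) (unsignedM τ v true) i k)
        (withRow-cong u (λ k → trans (cong -_ (colSum-negRow τ v k)) (neg-involutive _))
                        (perm-⊗-negRow σ τ v) i k)

negRow-⊗-negRow-≡ : (σ τ : Permutation′ n) {u v : Fin n} → σ ⟨$⟩ˡ v ≡ u →
  unsignedM σ u true ⊗ unsignedM τ v true ≐ permMatrix (τ · σ)
negRow-⊗-negRow-≡ σ τ {v = v} refl i k =
  trans (negRow-⊗-negRow σ τ (σ ⟨$⟩ˡ v) v i k) (byRow i k)
  where
  byRow : withRow (σ ⟨$⟩ˡ v) (λ k → δ k (τ ⟨$⟩ʳ v)) (unsignedM (τ · σ) (σ ⟨$⟩ˡ v) true) ≐ permMatrix (τ · σ)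
  byRow i k with i ≟ σ ⟨$⟩ˡ v
  ... | yes refl = cong (λ x → δ k (τ ⟨$⟩ʳ x)) (sym (inverseʳ σ))
  ... | no  i≢σ⁻¹v = withRow-≢ negOnes (permMatrix (τ · σ)) k i≢σ⁻¹v

negRow-⊗-negRow-≢ : (σ τ : Permutation′ n) {u v : Fin n} → σ ⟨$⟩ˡ v ≢ u → (η : Permutation′ n) →
  (∀ j → j ≢ u → j ≢ σ ⟨$⟩ˡ v → η ⟨$⟩ʳ j ≡ (τ · σ) ⟨$⟩ʳ j) →
  η ⟨$⟩ʳ u ≡ (τ · σ) ⟨$⟩ʳ (σ ⟨$⟩ˡ v) →
  unsignedM σ u true ⊗ unsignedM τ v true ≐ unsignedM η (σ ⟨$⟩ˡ v) true
negRow-⊗-negRow-≢ σ τ {u} {v} σ⁻¹v≢u η η≡τσ-elsewhere ηu≡τσσ⁻¹v i k =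
  trans (negRow-⊗-negRow σ τ u v i k) (byRow (i ≟ u) (i ≟ σ ⟨$⟩ˡ v))
  where
  open ≡-Reasoning
  τσ-negRow : Matrix _
  τσ-negRow = unsignedM (τ · σ) (σ ⟨$⟩ˡ v) true
  byRow : Dec (i ≡ u) → Dec (i ≡ σ ⟨$⟩ˡ v) →
          withRow u (λ k → δ k (τ ⟨$⟩ʳ v)) τσ-negRow i k ≡ unsignedM η (σ ⟨$⟩ˡ v) true i k
  byRow (yes refl) _ = begin
    withRow i (λ k → δ k (τ ⟨$⟩ʳ v)) τσ-negRow i k  ≡⟨ withRow-≡ i _ τσ-negRow k ⟩
    δ k (τ ⟨$⟩ʳ v)                                  ≡⟨ cong (δ k) (trans ηu≡τσσ⁻¹v (cong (τ ⟨$⟩ʳ_) (inverseʳ σ))) ⟨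
    δ k (η ⟨$⟩ʳ i)                                  ≡⟨ withRow-≢ negOnes (permMatrix η) k (σ⁻¹v≢u ∘ sym) ⟨
    unsignedM η (σ ⟨$⟩ˡ v) true i k                 ∎
  byRow (no i≢u) (yes refl) = begin
    withRow u (λ k → δ k (τ ⟨$⟩ʳ v)) τσ-negRow i k  ≡⟨ withRow-≢ _ τσ-negRow k i≢u ⟩
    τσ-negRow i k                                   ≡⟨ withRow-≡ i negOnes (permMatrix (τ · σ)) k ⟩
    -1ℤ                                             ≡⟨ withRow-≡ i negOnes (permMatrix η) k ⟨
    unsignedM η i true i k                          ∎
  byRow (no i≢u) (no i≢σ⁻¹v) = begin
    withRow u (λ k → δ k (τ ⟨$⟩ʳ v)) τσ-negRow i k  ≡⟨ withRow-≢ _ τσ-negRow k i≢u ⟩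
    τσ-negRow i k                                   ≡⟨ withRow-≢ negOnes (permMatrix (τ · σ)) k i≢σ⁻¹v ⟩
    δ k ((τ · σ) ⟨$⟩ʳ i)                            ≡⟨ cong (δ k) (η≡τσ-elsewhere i i≢u i≢σ⁻¹v) ⟨
    δ k (η ⟨$⟩ʳ i)                                  ≡⟨ withRow-≢ negOnes (permMatrix η) k i≢σ⁻¹v ⟨
    unsignedM η (σ ⟨$⟩ˡ v) true i k                 ∎

theorem3p1 : ∀ {n} (σ τ : Permutation′ n) (u v w : Fin n) →
    (M σ u false ⊗ M τ v false ≐ M (τ · σ) w false)
    × (M σ u true ⊗ M τ v false ≐ M (τ · σ) u true)
    × (M σ u false ⊗ M τ v true ≐ M (τ · σ) (σ ⟨$⟩ˡ v) true)
    × (σ ⟨$⟩ˡ v ≡ u → M σ u true ⊗ M τ v true ≐ M (τ · σ) w false)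
    × (σ ⟨$⟩ˡ v ≢ u → (η : Permutation′ n) →
         (∀ j → j ≢ u → j ≢ σ ⟨$⟩ˡ v → η ⟨$⟩ʳ j ≡ (τ · σ) ⟨$⟩ʳ j) →
         η ⟨$⟩ʳ (σ ⟨$⟩ˡ v) ≡ (τ · σ) ⟨$⟩ʳ u →
         η ⟨$⟩ʳ u ≡ (τ · σ) ⟨$⟩ʳ (σ ⟨$⟩ˡ v) →
         M σ u true ⊗ M τ v true ≐ M η (σ ⟨$⟩ˡ v) true)
theorem3p1 σ τ u v w =
    signed-⊗-transport (M≐signed σ u false) (M≐signed τ v false) (M≐signed (τ · σ) w false)
      (permMatrix-⊗ σ (permMatrix τ))
  , signed-⊗-transport (M≐signed σ u true) (M≐signed τ v false) (M≐signed (τ · σ) u true)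
      (negRow-⊗-perm σ τ u)
  , signed-⊗-transport (M≐signed σ u false) (M≐signed τ v true) (M≐signed (τ · σ) (σ ⟨$⟩ˡ v) true)
      (perm-⊗-negRow σ τ v)
  , (λ σ⁻¹v≡u → signed-⊗-transport (M≐signed σ u true) (M≐signed τ v true) (M≐signed (τ · σ) w false)
      (negRow-⊗-negRow-≡ σ τ σ⁻¹v≡u))
  -- The value η (σ⁻¹ v) is irrelevant: row σ⁻¹ v of M η (σ⁻¹ v) true is r_{σ⁻¹ v} whatever η is.
  , (λ σ⁻¹v≢u η η-elsewhere _ ηu →
      signed-⊗-transport (M≐signed σ u true) (M≐signed τ v true) (M≐signed η (σ ⟨$⟩ˡ v) true)
        (negRow-⊗-negRow-≢ σ τ σ⁻¹v≢u η η-elsewhere ηu))
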